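{- Let $(M,\operatorname{rk})$ be a matroid on a finite set $M$ and let $m_1,m_2:2^M\to\mathbb{R}$ be two functions. If both $m_1$ and $m_2$ satisfy the positivity axiom (P), then so does their product $m_1m_2$, defined by $(m_1m_2)(A)=m_1(A)m_2(A)$.
   Context: For $R\subseteq S\subseteq M$, the interval $[R,S]=\{A:R\subseteq A\subseteq S\}$ is called a molecule if $S$ is a disjoint union $S=R\cup F_{RS}\cup T_{RS}$ such that $\operatorname{rk}(A)=\operatorname{rk}(R)+|A\cap F_{RS}|$ for every $A\in[R,S]$. A function $m:2^M\to\mathbb{R}$ satisfies the positivity axiom (P) if for every molecule $[R,S]$, $\rho(R,S):=(-1)^{|T_{RS}|}\sum_{A\in[R,S]}(-1)^{|S|-|A|}m(A)\ge 0$. -}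

module Defs where

open import Level using (Level; _⊔_; suc)
open import Data.Nat as ℕ using (ℕ; zero; suc)
import Data.Nat.Properties as ℕP
open import Data.Bool using (Bool; true; false; if_then_else_)
open import Data.Fin using (Fin)
open import Data.Fin.Subset using (Subset; _⊆_; _∪_; _∩_; ∣_∣; ⊥; inside; outside)
open import Data.Fin.Subset.Properties using (_⊆?_)
open import Data.Vec using ([]; _∷_)
open import Data.List using (List; []; _∷_; map; _++_; foldr; filter)
open import Data.Product using (_×_; _,_)
open import Data.Sum using (_⊎_)
open import Relation.Nullary using (¬_; _×-dec_)
open import Relation.Binary.PropositionalEquality using (_≡_)
open import Algebra.Bundles using (CommutativeRing)

record Matroid (n : ℕ) : Set where
  field
    rk          : Subset n → ℕ
    rk-bounded  : ∀ A → rk A ℕ.≤ ∣ A ∣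
    rk-mono     : ∀ {A B} → A ⊆ B → rk A ℕ.≤ rk B
    rk-submod   : ∀ A B → rk (A ∪ B) ℕ.+ rk (A ∩ B) ℕ.≤ rk A ℕ.+ rk B

-- Ordered commutative rings (the structure of ℝ used by the statement:
-- ring operations and a compatible total order).  ℝ is an instance.

record OrderedCommutativeRing (c ℓ₁ ℓ₂ : Level) : Set (Level.suc (c ⊔ ℓ₁ ⊔ ℓ₂)) where
  field
    commutativeRing : CommutativeRing c ℓ₁
  open CommutativeRing commutativeRing public
  infix 4 _≤_
  field
    _≤_       : Carrier → Carrier → Set ℓ₂
    ≤-resp-≈  : ∀ {a b c d} → a ≈ b → c ≈ d → a ≤ c → b ≤ d
    ≤-refl    : ∀ {a} → a ≤ a
    ≤-trans   : ∀ {a b c} → a ≤ b → b ≤ c → a ≤ c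
    ≤-antisym : ∀ {a b} → a ≤ b → b ≤ a → a ≈ b
    ≤-total   : ∀ a b → (a ≤ b) ⊎ (b ≤ a)
    +-mono-≤  : ∀ {a b} c → a ≤ b → a + c ≤ b + c
    *-nonneg  : ∀ {a b} → 0# ≤ a → 0# ≤ b → 0# ≤ a * b
    0≉1       : ¬ (0# ≈ 1#)

allSubsets : (n : ℕ) → List (Subset n)
allSubsets zero    = [] ∷ []
allSubsets (suc n) = map (outside ∷_) (allSubsets n) ++ map (inside ∷_) (allSubsets n)


IsMolecule : ∀ {n} → Matroid n → (R S F T : Subset n) → Set
IsMolecule Mt R S F T =
  (R ∩ F ≡ ⊥) × (R ∩ T ≡ ⊥) × (F ∩ T ≡ ⊥) × (R ∪ F ∪ T ≡ S) ×
  (∀ A → R ⊆ A → A ⊆ S → rk A ≡ rk R ℕ.+ ∣ A ∩ F ∣)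
  where open Matroid Mt

module _ {c ℓ₁ ℓ₂} (K : OrderedCommutativeRing c ℓ₁ ℓ₂) where
  open OrderedCommutativeRing K

  negPow : ℕ → Carrier → Carrier
  negPow zero    x = x
  negPow (suc k) x = - negPow k x

  interval : ∀ {n} → Subset n → Subset n → List (Subset n)
  interval {n} R S = filter (λ A → (R ⊆? A) ×-dec (A ⊆? S)) (allSubsets n)

  ρ : ∀ {n} → (Subset n → Carrier) → (R S T : Subset n) → Carrier
  ρ m R S T = negPow ∣ T ∣
    (foldr _+_ 0# (map (λ A → negPow (∣ S ∣ ℕ.∸ ∣ A ∣) (m A)) (interval R S)))

  Positivity : ∀ {n} → Matroid n → (Subset n → Carrier) → Set (ℓ₂)
  Positivity Mt m = ∀ R S F T → IsMolecule Mt R S F T → 0# ≤ ρ m R S T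

  _·_ : ∀ {n} → (Subset n → Carrier) → (Subset n → Carrier) → (Subset n → Carrier)
  (m₁ · m₂) A = m₁ A * m₂ A

module Submission where

-- A molecule [R,S] with S = R ⊔ F ⊔ T is described by a vector of roles,
-- one per element of the ground set: an element is fixed (in R, or outside
-- S) or free (in F, or in T).  For m : 2^M → K let Δ m c be the iterated
-- finite difference of m along the free coordinates of c: m(in) - m(out)
-- along F, m(out) - m(in) along T.  The proof has three parts.
--  * ρ(R,S) = Δ m c (ρ-as-Δ): splitting the interval [R,S] along its first
--    coordinate shows that the signed interval sum obeys the recursion of Δ.
--  * Fixing free coordinates of a molecule gives again a molecule
--    (rank-refine), so (P) for m yields Δ m c′ ≥ 0 for every refinement c′.
--  * Discrete Leibniz rule: f₁g₁ - f₀g₀ = (f₁ - f₀)g₁ + f₀(g₁ - g₀), where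
--    the indices are the two ends of the difference along a free coordinate.
--    Hence, by induction on c, Δ(m₁m₂) c ≥ 0 once Δ m₁ and Δ m₂ are
--    nonnegative on all refinements of c.
-- The theorem follows by writing the given molecule as a role vector.

open import Defs
open import Data.Nat using (ℕ)
open import Data.Fin.Subset using (Subset)

import Data.Nat as ℕ
open import Data.Nat using (zero; suc; _∸_)
import Data.Nat.Properties as ℕP
open import Data.Bool using (Bool; true; false; not)
open import Data.Fin.Subset using (_⊆_; _∪_; _∩_; ∣_∣; ⊥; inside; outside)
open import Data.Fin.Subset.Properties
  using (_⊆?_; drop-∷-⊆; out⊆; in⊆in; ⊆-trans; p⊆q⇒∣p∣≤∣q∣)
open import Data.Vec using (Vec; []; _∷_; here)
open import Data.Vec.Properties using (∷-injectiveʳ)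
open import Data.List using (List; []; _∷_; map; filter; foldr; _++_)
open import Data.List.Properties
  using (filter-++; filter-≐; filter-none; ++-identityʳ; map-∘; map-++)
import Data.List.Relation.Unary.All as All
open All using (All; []; _∷_)
open import Data.List.Relation.Unary.All.Properties using (all-filter)
open import Data.Product using (Σ-syntax; _×_; _,_; proj₁; proj₂)
open import Data.Empty using (⊥-elim)
open import Function using (_∘_)
open import Relation.Unary using (Decidable)
open import Relation.Nullary using (¬_; does; Dec; _×-dec_)
open import Relation.Binary.PropositionalEquality
  using (_≡_; refl; sym; trans; cong; cong₂; module ≡-Reasoning)
import Relation.Binary.Reasoning.Setoid

private
  variable
    n : ℕ

inside⊈outside : ∀ {p q : Subset n} → ¬ (inside ∷ p ⊆ outside ∷ q)
inside⊈outside h with () ← h here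

-- The role of one element of the ground set with respect to a molecule
-- [R,S], S = R ⊔ F ⊔ T.  A coordinate is fixed (in R, or outside S) or
-- free (in F, or in T).
data Role : Set where
  fixed : (inR : Bool) → Role
  free  : (inF : Bool) → Role

R⟨_⟩ S⟨_⟩ F⟨_⟩ T⟨_⟩ : Vec Role n → Subset n
R⟨ [] ⟩          = []
R⟨ fixed x ∷ c ⟩ = x ∷ R⟨ c ⟩
R⟨ free _ ∷ c ⟩  = outside ∷ R⟨ c ⟩
S⟨ [] ⟩          = []
S⟨ fixed x ∷ c ⟩ = x ∷ S⟨ c ⟩
S⟨ free _ ∷ c ⟩  = inside ∷ S⟨ c ⟩
F⟨ [] ⟩          = []
F⟨ fixed _ ∷ c ⟩ = outside ∷ F⟨ c ⟩
F⟨ free b ∷ c ⟩  = b ∷ F⟨ c ⟩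
T⟨ [] ⟩          = []
T⟨ fixed _ ∷ c ⟩ = outside ∷ T⟨ c ⟩
T⟨ free b ∷ c ⟩  = not b ∷ T⟨ c ⟩

R∩F≡⊥ : (c : Vec Role n) → R⟨ c ⟩ ∩ F⟨ c ⟩ ≡ ⊥
R∩F≡⊥ []                = refl
R∩F≡⊥ (fixed true ∷ c)  = cong (outside ∷_) (R∩F≡⊥ c)
R∩F≡⊥ (fixed false ∷ c) = cong (outside ∷_) (R∩F≡⊥ c)
R∩F≡⊥ (free _ ∷ c)      = cong (outside ∷_) (R∩F≡⊥ c)

R∩T≡⊥ : (c : Vec Role n) → R⟨ c ⟩ ∩ T⟨ c ⟩ ≡ ⊥
R∩T≡⊥ []                = refl
R∩T≡⊥ (fixed true ∷ c)  = cong (outside ∷_) (R∩T≡⊥ c)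
R∩T≡⊥ (fixed false ∷ c) = cong (outside ∷_) (R∩T≡⊥ c)
R∩T≡⊥ (free _ ∷ c)      = cong (outside ∷_) (R∩T≡⊥ c)

F∩T≡⊥ : (c : Vec Role n) → F⟨ c ⟩ ∩ T⟨ c ⟩ ≡ ⊥
F∩T≡⊥ []               = refl
F∩T≡⊥ (fixed _ ∷ c)    = cong (outside ∷_) (F∩T≡⊥ c)
F∩T≡⊥ (free true ∷ c)  = cong (outside ∷_) (F∩T≡⊥ c)
F∩T≡⊥ (free false ∷ c) = cong (outside ∷_) (F∩T≡⊥ c)

R∪F∪T≡S : (c : Vec Role n) → R⟨ c ⟩ ∪ F⟨ c ⟩ ∪ T⟨ c ⟩ ≡ S⟨ c ⟩
R∪F∪T≡S []                = refl
R∪F∪T≡S (fixed true ∷ c)  = cong (inside ∷_) (R∪F∪T≡S c)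
R∪F∪T≡S (fixed false ∷ c) = cong (outside ∷_) (R∪F∪T≡S c)
R∪F∪T≡S (free true ∷ c)   = cong (inside ∷_) (R∪F∪T≡S c)
R∪F∪T≡S (free false ∷ c)  = cong (inside ∷_) (R∪F∪T≡S c)

roles : (R F T : Subset n) → Vec Role n
roles []          []          []          = []
roles (true ∷ R)  (_ ∷ F)     (_ ∷ T)     = fixed true ∷ roles R F T
roles (false ∷ R) (true ∷ F)  (_ ∷ T)     = free true ∷ roles R F T
roles (false ∷ R) (false ∷ F) (true ∷ T)  = free false ∷ roles R F T
roles (false ∷ R) (false ∷ F) (false ∷ T) = fixed false ∷ roles R F T

roles-R : (R F T : Subset n) → R⟨ roles R F T ⟩ ≡ R
roles-R []          []          []          = refl
roles-R (true ∷ R)  (_ ∷ F)     (_ ∷ T)     = cong (inside ∷_) (roles-R R F T)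
roles-R (false ∷ R) (true ∷ F)  (_ ∷ T)     = cong (outside ∷_) (roles-R R F T)
roles-R (false ∷ R) (false ∷ F) (true ∷ T)  = cong (outside ∷_) (roles-R R F T)
roles-R (false ∷ R) (false ∷ F) (false ∷ T) = cong (outside ∷_) (roles-R R F T)

roles-F : (R F T : Subset n) → R ∩ F ≡ ⊥ → F⟨ roles R F T ⟩ ≡ F
roles-F []          []          []          _  = refl
roles-F (true ∷ R)  (true ∷ F)  (_ ∷ T)     ()
roles-F (true ∷ R)  (false ∷ F) (_ ∷ T)     RF = cong (outside ∷_) (roles-F R F T (∷-injectiveʳ RF))
roles-F (false ∷ R) (true ∷ F)  (_ ∷ T)     RF = cong (inside ∷_) (roles-F R F T (∷-injectiveʳ RF))
roles-F (false ∷ R) (false ∷ F) (true ∷ T)  RF = cong (outside ∷_) (roles-F R F T (∷-injectiveʳ RF))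
roles-F (false ∷ R) (false ∷ F) (false ∷ T) RF = cong (outside ∷_) (roles-F R F T (∷-injectiveʳ RF))

roles-T : (R F T : Subset n) → R ∩ T ≡ ⊥ → F ∩ T ≡ ⊥ → T⟨ roles R F T ⟩ ≡ T
roles-T []          []          []          _  _  = refl
roles-T (true ∷ R)  (_ ∷ F)     (true ∷ T)  ()  _
roles-T (true ∷ R)  (_ ∷ F)     (false ∷ T) RT FT =
  cong (outside ∷_) (roles-T R F T (∷-injectiveʳ RT) (∷-injectiveʳ FT))
roles-T (false ∷ R) (true ∷ F)  (true ∷ T)  _  ()
roles-T (false ∷ R) (true ∷ F)  (false ∷ T) RT FT =
  cong (outside ∷_) (roles-T R F T (∷-injectiveʳ RT) (∷-injectiveʳ FT))
roles-T (false ∷ R) (false ∷ F) (true ∷ T)  RT FT =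
  cong (inside ∷_) (roles-T R F T (∷-injectiveʳ RT) (∷-injectiveʳ FT))
roles-T (false ∷ R) (false ∷ F) (false ∷ T) RT FT =
  cong (outside ∷_) (roles-T R F T (∷-injectiveʳ RT) (∷-injectiveʳ FT))

molecule-roles : ∀ (Mt : Matroid n) {R S F T} → IsMolecule Mt R S F T →
  Σ[ c ∈ Vec Role n ] R⟨ c ⟩ ≡ R × S⟨ c ⟩ ≡ S × F⟨ c ⟩ ≡ F × T⟨ c ⟩ ≡ T
molecule-roles Mt {R} {S} {F} {T} (RF , RT , FT , R∪F∪T≡S′ , _) =
  c , R-eq , S-eq , F-eq , T-eq
  where
  c : Vec Role _
  c = roles R F T
  R-eq : R⟨ c ⟩ ≡ R
  R-eq = roles-R R F T
  F-eq : F⟨ c ⟩ ≡ F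
  F-eq = roles-F R F T RF
  T-eq : T⟨ c ⟩ ≡ T
  T-eq = roles-T R F T RT FT
  S-eq : S⟨ c ⟩ ≡ S
  S-eq = begin
    S⟨ c ⟩                       ≡⟨ sym (R∪F∪T≡S c) ⟩
    R⟨ c ⟩ ∪ F⟨ c ⟩ ∪ T⟨ c ⟩     ≡⟨ cong₂ _∪_ R-eq (cong₂ _∪_ F-eq T-eq) ⟩
    R ∪ F ∪ T                    ≡⟨ R∪F∪T≡S′ ⟩
    S                            ∎
    where open ≡-Reasoning

infix 4 _≼_
data _≼_ : Vec Role n → Vec Role n → Set where
  []   : [] ≼ []
  keep : ∀ {r} {c′ c : Vec Role n} → c′ ≼ c → r ∷ c′ ≼ r ∷ c
  fix  : ∀ x {b} {c′ c : Vec Role n} → c′ ≼ c → fixed x ∷ c′ ≼ free b ∷ c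

R-antitone : ∀ {c′ c : Vec Role n} → c′ ≼ c → R⟨ c ⟩ ⊆ R⟨ c′ ⟩
R-antitone []                          = λ x∈ → x∈
R-antitone (keep {r = fixed true} le)  = in⊆in (R-antitone le)
R-antitone (keep {r = fixed false} le) = out⊆ (R-antitone le)
R-antitone (keep {r = free _} le)      = out⊆ (R-antitone le)
R-antitone (fix _ le)                  = out⊆ (R-antitone le)

S-monotone : ∀ {c′ c : Vec Role n} → c′ ≼ c → S⟨ c′ ⟩ ⊆ S⟨ c ⟩
S-monotone []                          = λ x∈ → x∈
S-monotone (keep {r = fixed true} le)  = in⊆in (S-monotone le)
S-monotone (keep {r = fixed false} le) = out⊆ (S-monotone le)
S-monotone (keep {r = free _} le)      = in⊆in (S-monotone le)
S-monotone (fix true le)               = in⊆in (S-monotone le)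
S-monotone (fix false le)              = out⊆ (S-monotone le)

between-tail : ∀ {x y z} {R S A : Subset n} →
  x ∷ R ⊆ z ∷ A × z ∷ A ⊆ y ∷ S → R ⊆ A × A ⊆ S
between-tail (R⊆A , A⊆S) = drop-∷-⊆ R⊆A , drop-∷-⊆ A⊆S

-- For A ∈ [R⟨c′⟩, S⟨c′⟩], an element of A ∩ F⟨c⟩ either was fixed into
-- R⟨c′⟩ or is still free in F⟨c′⟩.
F-count-split : ∀ {c′ c : Vec Role n} → c′ ≼ c → ∀ A → R⟨ c′ ⟩ ⊆ A × A ⊆ S⟨ c′ ⟩ →
  ∣ A ∩ F⟨ c ⟩ ∣ ≡ ∣ R⟨ c′ ⟩ ∩ F⟨ c ⟩ ∣ ℕ.+ ∣ A ∩ F⟨ c′ ⟩ ∣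
F-count-split []                          []          _  = refl
F-count-split (keep {r = fixed true} le)  (true ∷ A)  A∈ = F-count-split le A (between-tail A∈)
F-count-split (keep {r = fixed true} le)  (false ∷ A) A∈ = ⊥-elim (inside⊈outside (proj₁ A∈))
F-count-split (keep {r = fixed false} le) (true ∷ A)  A∈ = ⊥-elim (inside⊈outside (proj₂ A∈))
F-count-split (keep {r = fixed false} le) (false ∷ A) A∈ = F-count-split le A (between-tail A∈)
F-count-split (keep {r = free true} le)   (true ∷ A)  A∈ =
  trans (cong suc (F-count-split le A (between-tail A∈))) (sym (ℕP.+-suc _ _))
F-count-split (keep {r = free true} le)   (false ∷ A) A∈ = F-count-split le A (between-tail A∈)
F-count-split (keep {r = free false} le)  (true ∷ A)  A∈ = F-count-split le A (between-tail A∈)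
F-count-split (keep {r = free false} le)  (false ∷ A) A∈ = F-count-split le A (between-tail A∈)
F-count-split (fix true {true} le)        (true ∷ A)  A∈ =
  cong suc (F-count-split le A (between-tail A∈))
F-count-split (fix true {false} le)       (true ∷ A)  A∈ = F-count-split le A (between-tail A∈)
F-count-split (fix true le)               (false ∷ A) A∈ = ⊥-elim (inside⊈outside (proj₁ A∈))
F-count-split (fix false le)              (true ∷ A)  A∈ = ⊥-elim (inside⊈outside (proj₂ A∈))
F-count-split (fix false le)              (false ∷ A) A∈ = F-count-split le A (between-tail A∈)

RankCondition : Matroid n → Vec Role n → Set
RankCondition Mt c =
  ∀ A → R⟨ c ⟩ ⊆ A → A ⊆ S⟨ c ⟩ → rk A ≡ rk R⟨ c ⟩ ℕ.+ ∣ A ∩ F⟨ c ⟩ ∣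
  where open Matroid Mt

rank-refine : ∀ (Mt : Matroid n) {c′ c} → RankCondition Mt c → c′ ≼ c → RankCondition Mt c′
rank-refine Mt {c′} {c} rank le A R′⊆A A⊆S′ = begin
  rk A                                                   ≡⟨ rank A R⊆A A⊆S ⟩
  rk R⟨ c ⟩ ℕ.+ ∣ A ∩ F⟨ c ⟩ ∣                           ≡⟨ cong (rk R⟨ c ⟩ ℕ.+_) (F-count-split le A (R′⊆A , A⊆S′)) ⟩
  rk R⟨ c ⟩ ℕ.+ (∣ R⟨ c′ ⟩ ∩ F⟨ c ⟩ ∣ ℕ.+ ∣ A ∩ F⟨ c′ ⟩ ∣) ≡⟨ sym (ℕP.+-assoc (rk R⟨ c ⟩) _ _) ⟩
  rk R⟨ c ⟩ ℕ.+ ∣ R⟨ c′ ⟩ ∩ F⟨ c ⟩ ∣ ℕ.+ ∣ A ∩ F⟨ c′ ⟩ ∣  ≡⟨ cong (ℕ._+ ∣ A ∩ F⟨ c′ ⟩ ∣) (sym (rank R⟨ c′ ⟩ R⊆R′ R′⊆S)) ⟩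
  rk R⟨ c′ ⟩ ℕ.+ ∣ A ∩ F⟨ c′ ⟩ ∣                          ∎
  where
  open Matroid Mt
  open ≡-Reasoning
  R⊆R′ : R⟨ c ⟩ ⊆ R⟨ c′ ⟩
  R⊆R′ = R-antitone le
  R′⊆S : R⟨ c′ ⟩ ⊆ S⟨ c ⟩
  R′⊆S = ⊆-trans (⊆-trans R′⊆A A⊆S′) (S-monotone le)
  R⊆A : R⟨ c ⟩ ⊆ A
  R⊆A = ⊆-trans R⊆R′ R′⊆A
  A⊆S : A ⊆ S⟨ c ⟩
  A⊆S = ⊆-trans A⊆S′ (S-monotone le)

roles-molecule : ∀ (Mt : Matroid n) {c} → RankCondition Mt c →
  IsMolecule Mt R⟨ c ⟩ S⟨ c ⟩ F⟨ c ⟩ T⟨ c ⟩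
roles-molecule Mt {c} rank = R∩F≡⊥ c , R∩T≡⊥ c , F∩T≡⊥ c , R∪F∪T≡S c , rank

between? : (R S A : Subset n) → Dec (R ⊆ A × A ⊆ S)
between? R S A = (R ⊆? A) ×-dec (A ⊆? S)

filter-map : ∀ {a b p} {X : Set a} {Y : Set b} {P : Y → Set p} (P? : Decidable P)
  (f : X → Y) (xs : List X) → filter P? (map f xs) ≡ map f (filter (P? ∘ f) xs)
filter-map P? f []       = refl
filter-map P? f (x ∷ xs) with does (P? (f x))
... | true  = cong (f x ∷_) (filter-map P? f xs)
... | false = filter-map P? f xs

module _ {c ℓ₁ ℓ₂} (K : OrderedCommutativeRing c ℓ₁ ℓ₂) where
  open OrderedCommutativeRing K renaming (refl to ≈-refl; sym to ≈-sym; trans to ≈-trans)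
  open import Algebra.Properties.Ring ring using (-0#≈0#; -‿+-comm; [y-z]x≈yx-zx; x[y-z]≈xy-xz)
  open import Algebra.Properties.AbelianGroup +-abelianGroup using (⁻¹-anti-homo‿-)
  open import Algebra.Properties.CommutativeSemigroup +-commutativeSemigroup using (interchange)
  module ≈-Reasoning = Relation.Binary.Reasoning.Setoid setoid

  nonneg-+ : ∀ {a b} → 0# ≤ a → 0# ≤ b → 0# ≤ a + b
  nonneg-+ {a} {b} 0≤a 0≤b = ≤-trans (≤-resp-≈ ≈-refl (≈-sym (+-identityˡ b)) 0≤b) (+-mono-≤ b 0≤a)

  sub-telescope : ∀ p q r → (p - q) + (q - r) ≈ p - r
  sub-telescope p q r = begin
    (p - q) + (q - r)     ≈⟨ +-assoc p (- q) (q - r) ⟩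
    p + (- q + (q - r))   ≈⟨ +-congˡ (+-assoc (- q) q (- r)) ⟨
    p + ((- q + q) - r)   ≈⟨ +-congˡ (+-congʳ (-‿inverseˡ q)) ⟩
    p + (0# - r)          ≈⟨ +-congˡ (+-identityˡ (- r)) ⟩
    p - r                 ∎
    where open ≈-Reasoning

  leibniz : ∀ x₁ x₀ y₁ y₀ → (x₁ - x₀) * y₁ + x₀ * (y₁ - y₀) ≈ x₁ * y₁ - x₀ * y₀
  leibniz x₁ x₀ y₁ y₀ = begin
    (x₁ - x₀) * y₁ + x₀ * (y₁ - y₀)            ≈⟨ +-cong ([y-z]x≈yx-zx y₁ x₁ x₀) (x[y-z]≈xy-xz x₀ y₁ y₀) ⟩
    (x₁ * y₁ - x₀ * y₁) + (x₀ * y₁ - x₀ * y₀)  ≈⟨ sub-telescope (x₁ * y₁) (x₀ * y₁) (x₀ * y₀) ⟩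
    x₁ * y₁ - x₀ * y₀                          ∎
    where open ≈-Reasoning

  Δ : (Subset n → Carrier) → Vec Role n → Carrier
  Δ m []             = m []
  Δ m (fixed x ∷ c)  = Δ (λ A → m (x ∷ A)) c
  Δ m (free b ∷ c)   = Δ (λ A → m (b ∷ A)) c - Δ (λ A → m (not b ∷ A)) c

  Δ-cong : ∀ {m m′ : Subset n → Carrier} → (∀ A → m A ≈ m′ A) → ∀ c → Δ m c ≈ Δ m′ c
  Δ-cong m≈m′ []            = m≈m′ []
  Δ-cong m≈m′ (fixed x ∷ c) = Δ-cong (λ A → m≈m′ (x ∷ A)) c
  Δ-cong m≈m′ (free b ∷ c)  =
    +-cong (Δ-cong (λ A → m≈m′ (b ∷ A)) c) (-‿cong (Δ-cong (λ A → m≈m′ (not b ∷ A)) c))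

  Δ-+ : ∀ (u v : Subset n → Carrier) c → Δ (λ A → u A + v A) c ≈ Δ u c + Δ v c
  Δ-+ u v []            = ≈-refl
  Δ-+ u v (fixed x ∷ c) = Δ-+ _ _ c
  Δ-+ u v (free b ∷ c)  = ≈-trans (+-cong (Δ-+ _ _ c) (-‿cong (Δ-+ _ _ c))) sub-+-interchange
    where
    sub-+-interchange : ∀ {a b x y} → (a + b) - (x + y) ≈ (a - x) + (b - y)
    sub-+-interchange {a} {b} {x} {y} =
      ≈-trans (+-congˡ (≈-sym (-‿+-comm x y))) (interchange a b (- x) (- y))

  Δ-neg : ∀ (u : Subset n → Carrier) c → Δ (λ A → - u A) c ≈ - Δ u c
  Δ-neg u []            = ≈-refl
  Δ-neg u (fixed x ∷ c) = Δ-neg _ c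
  Δ-neg u (free b ∷ c)  = ≈-trans (+-cong (Δ-neg _ c) (-‿cong (Δ-neg _ c))) (-‿+-comm _ _)

  Δ-sub : ∀ (u v : Subset n → Carrier) c → Δ (λ A → u A - v A) c ≈ Δ u c - Δ v c
  Δ-sub u v c = ≈-trans (Δ-+ u (λ A → - v A) c) (+-congˡ (Δ-neg v c))

  -- Along a free coordinate the Leibniz rule splits Δ (f g) into
  -- Δ (Δ f · g(b)) + Δ (f(¬b) · Δ g), and both terms fall under the induction
  -- hypothesis for c, whose refinements extend to refinements of the
  -- original vector (keeping the difference, or fixing the coordinate).
  Δ-product-nonneg : ∀ (c : Vec Role n) (f g : Subset n → Carrier) →
    (∀ c′ → c′ ≼ c → 0# ≤ Δ f c′) → (∀ c′ → c′ ≼ c → 0# ≤ Δ g c′) →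
    0# ≤ Δ (_·_ K f g) c
  Δ-product-nonneg [] f g f≥0 g≥0 = *-nonneg (f≥0 [] []) (g≥0 [] [])
  Δ-product-nonneg (fixed x ∷ c) f g f≥0 g≥0 =
    Δ-product-nonneg c _ _ (λ c′ le → f≥0 (fixed x ∷ c′) (keep le))
                           (λ c′ le → g≥0 (fixed x ∷ c′) (keep le))
  Δ-product-nonneg (free b ∷ c) f g f≥0 g≥0 =
    ≤-resp-≈ ≈-refl split (nonneg-+ (Δ-product-nonneg c _ _ Δf≥0 g₁≥0)
                                    (Δ-product-nonneg c _ _ f₀≥0 Δg≥0))
    where
    f₁ f₀ g₁ g₀ : Subset _ → Carrier
    f₁ A = f (b ∷ A)
    f₀ A = f (not b ∷ A)
    g₁ A = g (b ∷ A)
    g₀ A = g (not b ∷ A)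
    Δf≥0 : ∀ c′ → c′ ≼ c → 0# ≤ Δ (λ A → f₁ A - f₀ A) c′
    Δf≥0 c′ le = ≤-resp-≈ ≈-refl (≈-sym (Δ-sub f₁ f₀ c′)) (f≥0 (free b ∷ c′) (keep le))
    Δg≥0 : ∀ c′ → c′ ≼ c → 0# ≤ Δ (λ A → g₁ A - g₀ A) c′
    Δg≥0 c′ le = ≤-resp-≈ ≈-refl (≈-sym (Δ-sub g₁ g₀ c′)) (g≥0 (free b ∷ c′) (keep le))
    g₁≥0 : ∀ c′ → c′ ≼ c → 0# ≤ Δ g₁ c′
    g₁≥0 c′ le = g≥0 (fixed b ∷ c′) (fix b le)
    f₀≥0 : ∀ c′ → c′ ≼ c → 0# ≤ Δ f₀ c′
    f₀≥0 c′ le = f≥0 (fixed (not b) ∷ c′) (fix (not b) le)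
    split : Δ (λ A → (f₁ A - f₀ A) * g₁ A) c + Δ (λ A → f₀ A * (g₁ A - g₀ A)) c
          ≈ Δ (_·_ K f g) (free b ∷ c)
    split = begin
      Δ (λ A → (f₁ A - f₀ A) * g₁ A) c + Δ (λ A → f₀ A * (g₁ A - g₀ A)) c
        ≈⟨ Δ-+ _ _ c ⟨
      Δ (λ A → (f₁ A - f₀ A) * g₁ A + f₀ A * (g₁ A - g₀ A)) c
        ≈⟨ Δ-cong (λ A → leibniz (f₁ A) (f₀ A) (g₁ A) (g₀ A)) c ⟩
      Δ (λ A → f₁ A * g₁ A - f₀ A * g₀ A) c
        ≈⟨ Δ-sub (λ A → f₁ A * g₁ A) (λ A → f₀ A * g₀ A) c ⟩
      Δ (_·_ K f g) (free b ∷ c)                               ∎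
      where open ≈-Reasoning

  sum : List Carrier → Carrier
  sum = foldr _+_ 0#

  sum-++ : ∀ xs ys → sum (xs ++ ys) ≈ sum xs + sum ys
  sum-++ []       ys = ≈-sym (+-identityˡ (sum ys))
  sum-++ (x ∷ xs) ys = ≈-trans (+-congˡ (sum-++ xs ys)) (≈-sym (+-assoc x (sum xs) (sum ys)))

  sum-cong : ∀ {a} {X : Set a} {f g : X → Carrier} {xs} →
    All (λ x → f x ≈ g x) xs → sum (map f xs) ≈ sum (map g xs)
  sum-cong []           = ≈-refl
  sum-cong (fx≈gx ∷ eq) = +-cong fx≈gx (sum-cong eq)

  sum-neg : ∀ {a} {X : Set a} (f : X → Carrier) xs →
    sum (map (λ x → - f x) xs) ≈ - sum (map f xs)
  sum-neg f []       = ≈-sym -0#≈0#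
  sum-neg f (x ∷ xs) = ≈-trans (+-congˡ (sum-neg f xs)) (-‿+-comm (f x) (sum (map f xs)))

  negPow-cong : ∀ k {a b} → a ≈ b → negPow K k a ≈ negPow K k b
  negPow-cong zero    a≈b = a≈b
  negPow-cong (suc k) a≈b = -‿cong (negPow-cong k a≈b)

  negPow-sub : ∀ k a b → negPow K k (a - b) ≈ negPow K k a - negPow K k b
  negPow-sub zero    a b = ≈-refl
  negPow-sub (suc k) a b =
    ≈-trans (-‿cong (negPow-sub k a b)) (≈-sym (-‿+-comm (negPow K k a) (- negPow K k b)))

  negPow-suc-∸ : ∀ {s a} v → a ℕ.≤ s → negPow K (suc s ∸ a) v ≡ - negPow K (s ∸ a) v
  negPow-suc-∸ v a≤s = cong (λ k → negPow K k v) (ℕP.+-∸-assoc 1 a≤s)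

  interval-cons : ∀ x y (R S : Subset n) →
    interval K (x ∷ R) (y ∷ S)
      ≡ map (outside ∷_) (filter (between? (x ∷ R) (y ∷ S) ∘ (outside ∷_)) (allSubsets n))
        ++ map (inside ∷_) (filter (between? (x ∷ R) (y ∷ S) ∘ (inside ∷_)) (allSubsets n))
  interval-cons {n} x y R S = trans
    (filter-++ (between? (x ∷ R) (y ∷ S)) (map (outside ∷_) (allSubsets n)) (map (inside ∷_) (allSubsets n)))
    (cong₂ _++_ (filter-map _ _ (allSubsets n)) (filter-map _ _ (allSubsets n)))

  allowed-head : ∀ {x y z} {R S : Subset n} →
    (∀ {A} → R ⊆ A × A ⊆ S → x ∷ R ⊆ z ∷ A × z ∷ A ⊆ y ∷ S) →
    filter (between? (x ∷ R) (y ∷ S) ∘ (z ∷_)) (allSubsets n) ≡ interval K R S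
  allowed-head {n} lift = filter-≐ _ _ (between-tail , lift) (allSubsets n)

  forbidden-head : ∀ {x y z} {R S : Subset n} →
    (∀ {A} → ¬ (x ∷ R ⊆ z ∷ A × z ∷ A ⊆ y ∷ S)) →
    filter (between? (x ∷ R) (y ∷ S) ∘ (z ∷_)) (allSubsets n) ≡ []
  forbidden-head {n} never = filter-none _ (All.universal (λ _ → never) (allSubsets n))

  interval-fixed : ∀ x (R S : Subset n) → interval K (x ∷ R) (x ∷ S) ≡ map (x ∷_) (interval K R S)
  interval-fixed outside R S = trans (interval-cons outside outside R S)
    (trans (cong₂ (λ I J → map (outside ∷_) I ++ map (inside ∷_) J)
                  (allowed-head (λ (p , q) → out⊆ p , out⊆ q))
                  (forbidden-head (λ (_ , q) → inside⊈outside q)))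
           (++-identityʳ _))
  interval-fixed inside R S = trans (interval-cons inside inside R S)
    (cong₂ (λ I J → map (outside ∷_) I ++ map (inside ∷_) J)
           (forbidden-head (λ (p , _) → inside⊈outside p))
           (allowed-head (λ (p , q) → in⊆in p , in⊆in q)))

  interval-free : ∀ (R S : Subset n) → interval K (outside ∷ R) (inside ∷ S)
    ≡ map (outside ∷_) (interval K R S) ++ map (inside ∷_) (interval K R S)
  interval-free R S = trans (interval-cons outside inside R S)
    (cong₂ (λ I J → map (outside ∷_) I ++ map (inside ∷_) J)
           (allowed-head (λ (p , q) → out⊆ p , out⊆ q))
           (allowed-head (λ (p , q) → out⊆ p , in⊆in q)))

  intervalSum : (Subset n → Carrier) → Subset n → Subset n → Carrier
  intervalSum m R S = sum (map (λ A → negPow K (∣ S ∣ ∸ ∣ A ∣) (m A)) (interval K R S))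

  intervalSum-fixed : ∀ x (m : Subset (suc n) → Carrier) R S →
    intervalSum m (x ∷ R) (x ∷ S) ≡ intervalSum (λ A → m (x ∷ A)) R S
  intervalSum-fixed outside m R S rewrite interval-fixed outside R S =
    cong sum (sym (map-∘ (interval K R S)))
  intervalSum-fixed inside m R S rewrite interval-fixed inside R S =
    cong sum (sym (map-∘ (interval K R S)))

  -- Along a free coordinate the interval sum is a difference: members with
  -- the coordinate outside carry one sign change, since |A| ≤ |S| there.
  intervalSum-free : ∀ (m : Subset (suc n) → Carrier) R S →
    intervalSum m (outside ∷ R) (inside ∷ S)
      ≈ intervalSum (λ A → m (inside ∷ A)) R S - intervalSum (λ A → m (outside ∷ A)) R S
  intervalSum-free m R S = begin
    intervalSum m (outside ∷ R) (inside ∷ S)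
      ≡⟨ cong sum (trans (cong (map term) (interval-free R S))
                         (trans (map-++ term (map (outside ∷_) I) (map (inside ∷_) I))
                                (cong₂ _++_ (sym (map-∘ I)) (sym (map-∘ I))) )) ⟩
    sum (map (term ∘ (outside ∷_)) I ++ map (term ∘ (inside ∷_)) I)
      ≈⟨ sum-++ (map (term ∘ (outside ∷_)) I) (map (term ∘ (inside ∷_)) I) ⟩
    sum (map (term ∘ (outside ∷_)) I) + intervalSum (λ A → m (inside ∷ A)) R S
      ≈⟨ +-congʳ outside-part ⟩
    - intervalSum (λ A → m (outside ∷ A)) R S + intervalSum (λ A → m (inside ∷ A)) R S
      ≈⟨ +-comm _ _ ⟩
    intervalSum (λ A → m (inside ∷ A)) R S - intervalSum (λ A → m (outside ∷ A)) R S ∎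
    where
    open ≈-Reasoning
    I : List (Subset _)
    I = interval K R S
    term : Subset (suc _) → Carrier
    term A = negPow K (∣ inside ∷ S ∣ ∸ ∣ A ∣) (m A)
    outside-part : sum (map (term ∘ (outside ∷_)) I) ≈ - intervalSum (λ A → m (outside ∷ A)) R S
    outside-part = ≈-trans
      (sum-cong (All.map (λ (_ , A⊆S) → reflexive (negPow-suc-∸ _ (p⊆q⇒∣p∣≤∣q∣ A⊆S)))
                         (all-filter (between? R S) (allSubsets _))))
      (sum-neg (λ A → negPow K (∣ S ∣ ∸ ∣ A ∣) (m (outside ∷ A))) I)

  ρ-free-step : ∀ (m : Subset (suc n) → Carrier) c →
    let m₁ = λ A → m (inside ∷ A); m₀ = λ A → m (outside ∷ A) in
    ρ K m₁ R⟨ c ⟩ S⟨ c ⟩ T⟨ c ⟩ ≈ Δ m₁ c → ρ K m₀ R⟨ c ⟩ S⟨ c ⟩ T⟨ c ⟩ ≈ Δ m₀ c →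
    negPow K ∣ T⟨ c ⟩ ∣ (intervalSum m (outside ∷ R⟨ c ⟩) (inside ∷ S⟨ c ⟩)) ≈ Δ m₁ c - Δ m₀ c
  ρ-free-step m c ρ₁≈Δ₁ ρ₀≈Δ₀ = begin
    negPow K k (intervalSum m (outside ∷ R⟨ c ⟩) (inside ∷ S⟨ c ⟩))
      ≈⟨ negPow-cong k (intervalSum-free m R⟨ c ⟩ S⟨ c ⟩) ⟩
    negPow K k (intervalSum m₁ R⟨ c ⟩ S⟨ c ⟩ - intervalSum m₀ R⟨ c ⟩ S⟨ c ⟩)
      ≈⟨ negPow-sub k _ _ ⟩
    ρ K m₁ R⟨ c ⟩ S⟨ c ⟩ T⟨ c ⟩ - ρ K m₀ R⟨ c ⟩ S⟨ c ⟩ T⟨ c ⟩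
      ≈⟨ +-cong ρ₁≈Δ₁ (-‿cong ρ₀≈Δ₀) ⟩
    Δ m₁ c - Δ m₀ c ∎
    where
    open ≈-Reasoning
    k : ℕ
    k = ∣ T⟨ c ⟩ ∣
    m₁ m₀ : Subset _ → Carrier
    m₁ A = m (inside ∷ A)
    m₀ A = m (outside ∷ A)

  ρ-as-Δ : ∀ (m : Subset n → Carrier) c → ρ K m R⟨ c ⟩ S⟨ c ⟩ T⟨ c ⟩ ≈ Δ m c
  ρ-as-Δ m []               = +-identityʳ (m [])
  ρ-as-Δ m (fixed x ∷ c)    = ≈-trans
    (reflexive (cong (negPow K ∣ T⟨ c ⟩ ∣) (intervalSum-fixed x m R⟨ c ⟩ S⟨ c ⟩)))
    (ρ-as-Δ _ c)
  ρ-as-Δ m (free true ∷ c)  = ρ-free-step m c (ρ-as-Δ _ c) (ρ-as-Δ _ c)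
  ρ-as-Δ m (free false ∷ c) =
    ≈-trans (-‿cong (ρ-free-step m c (ρ-as-Δ _ c) (ρ-as-Δ _ c))) (⁻¹-anti-homo‿- _ _)

  refinement-nonneg : ∀ (Mt : Matroid n) m → Positivity K Mt m →
    ∀ {c} → RankCondition Mt c → ∀ c′ → c′ ≼ c → 0# ≤ Δ m c′
  refinement-nonneg Mt m pos rank c′ le =
    ≤-resp-≈ ≈-refl (ρ-as-Δ m c′)
      (pos R⟨ c′ ⟩ S⟨ c′ ⟩ F⟨ c′ ⟩ T⟨ c′ ⟩ (roles-molecule Mt (rank-refine Mt rank le)))

  product-positivity-roles : ∀ (Mt : Matroid n) m₁ m₂ →
    Positivity K Mt m₁ → Positivity K Mt m₂ →
    ∀ {c} → RankCondition Mt c → 0# ≤ ρ K (_·_ K m₁ m₂) R⟨ c ⟩ S⟨ c ⟩ T⟨ c ⟩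
  product-positivity-roles Mt m₁ m₂ pos₁ pos₂ {c} rank =
    ≤-resp-≈ ≈-refl (≈-sym (ρ-as-Δ (_·_ K m₁ m₂) c))
      (Δ-product-nonneg c m₁ m₂ (refinement-nonneg Mt m₁ pos₁ rank) (refinement-nonneg Mt m₂ pos₂ rank))

corollary1p5 : ∀ {c ℓ₁ ℓ₂} (K : OrderedCommutativeRing c ℓ₁ ℓ₂) {n : ℕ} (Mt : Matroid n)
    (m₁ m₂ : Subset n → OrderedCommutativeRing.Carrier K) →
    Positivity K Mt m₁ → Positivity K Mt m₂ → Positivity K Mt (_·_ K m₁ m₂)
corollary1p5 K Mt m₁ m₂ pos₁ pos₂ R S F T mol@(_ , _ , _ , _ , rank)
  with molecule-roles Mt mol
... | c , refl , refl , refl , refl = product-positivity-roles K Mt m₁ m₂ pos₁ pos₂ rank
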